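{- Let $K$ be a cubic field with fundamental discriminant $d_K$ in which $3$ does not ramify, and let $F_K=(a,b,c,d)$ be an associated binary cubic form. Let $\mathcal{K}_F$ be the cube $(A,B)$ with $A=\begin{pmatrix}3a&b\\ b&c\end{pmatrix}$, $B=\begin{pmatrix}b&c\\ c&3d\end{pmatrix}$, and let $\mathcal{C}_{d_K}$ be the cube $(A',B')$ with $A'=\begin{pmatrix}0&3\\1&0\end{pmatrix}$ and $B'=\begin{pmatrix}\frac{d_K+3}{4}&3\\0&-1\end{pmatrix}$ if $d_K\equiv 1\pmod 4$, $B'=\begin{pmatrix}\frac{d_K}{4}&3\\0&-1\end{pmatrix}$ if $d_K\equiv 0\pmod 4$. Let $T_{F_K}=[\mathcal{K}_F]+[\mathcal{C}_{d_K}]\in \mathrm{Cl}(\mathbb{Z}^2\otimes\mathbb{Z}^2\otimes\mathbb{Z}^2;-3d_K)$. Then $$\big((\pi_1\circ\phi)(T_{F_K})\big)^{\pm1}=\tfrac12 q_K$$ as elements of $\mathrm{Cl}^+_{\mathbb{Q}(\sqrt{ -3d_K})}$, where $\frac12 q_K$ is the form $x\mapsto\frac12\mathrm{tr}_{K/\mathbb{Q}}(x^2)$ on $O_K^0$ in the $\mathbb{Z}$-basis $\{\alpha_0,3\beta_0\}$ if $b\equiv 0$, $\{3\alpha_0,\beta_0\}$ if $c\equiv 0$, $\{\alpha_0-\beta_0,3\beta_0\}$ if $b\equiv -c$, $\{\alpha_0+\beta_0,3\beta_0\}$ if $b\equiv c \pmod 3$.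
   Context: A fundamental discriminant is the discriminant of a quadratic field. $(a,b,c,d)$ denotes $ax^3+bx^2y+cxy^2+dy^3$. By Delone–Faddeev, $K$ has an associated integral binary cubic form $F_K=(a,b,c,d)$ (unique up to $\mathrm{GL}_2(\mathbb{Z})$) of discriminant $d_K$ such that for a root $\theta$ of $F_K(x,1)$, $K=\mathbb{Q}(\theta)$ and $\{1,-a\theta,d/\theta\}$ is a $\mathbb{Z}$-basis of $O_K$; put $\alpha=-a\theta$, $\beta=d/\theta$, $\alpha_0=\alpha-\mathrm{tr}(\alpha)/3$, $\beta_0=\beta-\mathrm{tr}(\beta)/3$, and $O_K^0=\{x\in O_K:\mathrm{tr}_{K/\mathbb{Q}}(x)=0\}$. A $2\times2\times2$ integral cube is a pair $(A,B)$ of $2\times2$ integer matrices; set $Q_1(A,B)=-\det(Ax+By)$, $Q_2(A,B)=-\det\big(A\binom{x}{y}\,|\,B\binom{x}{y}\big)$, $Q_3(A,B)=-\det\big(A^t\binom{x}{y}\,|\,B^t\binom{x}{y}\big)$; these have a common discriminant, the discriminant of the cube. $\Gamma=\mathrm{SL}_2(\mathbb{Z})^3$ acts on cubes preserving the discriminant. $\mathrm{Cl}(\mathbb{Z}^2\otimes\mathbb{Z}^2\otimes\mathbb{Z}^2;\Delta)$ is Bhargava's group of $\Gamma$-classes of cubes of discriminant $\Delta$ with $Q_1,Q_2,Q_3$ primitive, whose group law is such that $\phi:[(A,B)]\mapsto([Q_1],[Q_2])$ is a group isomorphism onto $\mathrm{Cl}^+_{\mathbb{Q}(\sqrt\Delta)}\times\mathrm{Cl}^+_{\mathbb{Q}(\sqrt\Delta)}$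 (narrow class groups identified with $\mathrm{SL}_2(\mathbb{Z})$-classes of primitive binary quadratic forms under Gauss composition); $\pi_1$ is the first projection. The cubes $\mathcal{K}_F$ and $\mathcal{C}_{d_K}$ define elements of this group for $\Delta=-3d_K$. -}

module Defs where

open import Data.Nat using (ℕ)
import Data.Nat as ℕ
import Data.Nat.Divisibility as ℕD
open import Data.Integer using (ℤ; +_; _+_; _-_; _*_; -_; ∣_∣)
open import Data.Integer.Divisibility using (_∣_)
open import Data.Integer.GCD using (gcd)
open import Data.Product using (Σ; ∃; ∃-syntax; _×_; _,_)
open import Data.Sum using (_⊎_)
open import Relation.Nullary using (¬_)
open import Relation.Binary.PropositionalEquality using (_≡_)

ModEq : ℤ → ℤ → ℤ → Set
ModEq m x y = m ∣ (x - y)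

SquareFree : ℤ → Set
SquareFree m = (n : ℕ) → ℕD._∣_ (n ℕ.* n) ∣ m ∣ → n ≡ 1

Fundamental : ℤ → Set
Fundamental D =
  (ModEq (+ 4) D (+ 1) × SquareFree D × ¬ (D ≡ + 1))
  ⊎ (∃[ m ] (D ≡ + 4 * m × SquareFree m
             × (ModEq (+ 4) m (+ 2) ⊎ ModEq (+ 4) m (+ 3))))

record LinForm : Set where
  constructor lin
  field p q : ℤ

-- binary quadratic form A x² + B xy + C y²
record BQF : Set where
  constructor bqf
  field A B C : ℤ

-- binary cubic form a x³ + b x²y + c xy² + d y³
record BCF : Set where
  constructor bcf
  field a b c d : ℤ

infixl 7 _⊗_
infixl 6 _⊕_ _⊖_
infixr 8 _·_
_⊗_ : LinForm → LinForm → BQF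
lin p q ⊗ lin r s = bqf (p * r) (p * s + q * r) (q * s)

_⊕_ : BQF → BQF → BQF
bqf A B C ⊕ bqf A' B' C' = bqf (A + A') (B + B') (C + C')

_⊖_ : BQF → BQF → BQF
bqf A B C ⊖ bqf A' B' C' = bqf (A - A') (B - B') (C - C')

_·_ : ℤ → BQF → BQF
k · bqf A B C = bqf (k * A) (k * B) (k * C)

negQ : BQF → BQF
negQ (bqf A B C) = bqf (- A) (- B) (- C)

disc : BQF → ℤ
disc (bqf A B C) = B * B - + 4 * A * C

Primitive : BQF → Set
Primitive (bqf A B C) = gcd (gcd A B) C ≡ + 1

substQ : BQF → LinForm → LinForm → BQF
substQ (bqf A B C) L₁ L₂ = (A · (L₁ ⊗ L₁)) ⊕ ((B · (L₁ ⊗ L₂)) ⊕ (C · (L₂ ⊗ L₂)))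

infix 4 _∼_
_∼_ : BQF → BQF → Set
f ∼ g = ∃[ p ] ∃[ q ] ∃[ r ] ∃[ s ]
          (p * s - q * r ≡ + 1 × g ≡ substQ f (lin p q) (lin r s))

invQ : BQF → BQF
invQ (bqf A B C) = bqf A (- B) C

-- Gauss composition via Dirichlet composition:
-- Composes f g h  means  [f]·[g] = [h]  in the form class group.
-- f ∼ (a₁,b₁,c₁), g ∼ (a₂,b₂,c₂) united (gcd(a₁,a₂,(b₁+b₂)/2) = 1, a₁a₂ ≠ 0),
-- and h ∼ (a₁a₂, B, C) with B ≡ b₁ (2a₁), B ≡ b₂ (2a₂), B² - 4a₁a₂C = D.
Composes : BQF → BQF → BQF → Set
Composes f g h =
  ∃[ a₁ ] ∃[ b₁ ] ∃[ c₁ ] ∃[ a₂ ] ∃[ b₂ ] ∃[ c₂ ] ∃[ n ] ∃[ B ] ∃[ C ]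
    ( f ∼ bqf a₁ b₁ c₁ × g ∼ bqf a₂ b₂ c₂
    × ¬ (a₁ ≡ + 0) × ¬ (a₂ ≡ + 0)
    × b₁ + b₂ ≡ + 2 * n × gcd (gcd a₁ a₂) n ≡ + 1
    × ModEq (+ 2 * a₁) B (b₁) × ModEq (+ 2 * a₂) B (b₂)
    × B * B - + 4 * (a₁ * a₂) * C ≡ disc f
    × h ∼ bqf (a₁ * a₂) B C )

discC : BCF → ℤ
discC (bcf a b c d) =
  b * b * c * c - + 4 * a * c * c * c - + 4 * b * b * b * d
  - + 27 * a * a * d * d + + 18 * a * b * c * d

mulLQ : LinForm → BQF → BCF
mulLQ (lin p q) (bqf r s t) = bcf (p * r) (p * s + q * r) (p * t + q * s) (q * t)

scaleC : ℤ → BCF → BCF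
scaleC k (bcf a b c d) = bcf (k * a) (k * b) (k * c) (k * d)

-- irreducible over ℚ: no factorisation into rational linear × quadratic
-- (denominators cleared by the nonzero integer k)
IrreducibleC : BCF → Set
IrreducibleC F = ¬ (∃[ k ] ∃[ L ] ∃[ Q ] (¬ (k ≡ + 0) × scaleC k F ≡ mulLQ L Q))

-- The cubic ring O = ℤ ⊕ ℤα ⊕ ℤβ attached to F = (a,b,c,d) (Delone–Faddeev),
-- α = -aθ, β = d/θ:  αβ = -ad,  α² = -ac + bα - aβ,  β² = -bd + dα - cβ.

-- u + vα + wβ
record Elt : Set where
  constructor elt
  field u v w : ℤ

mulO : BCF → Elt → Elt → Elt
mulO (bcf a b c d) (elt u₁ v₁ w₁) (elt u₂ v₂ w₂) =
  let vv = v₁ * v₂ ; vw = v₁ * w₂ + w₁ * v₂ ; ww = w₁ * w₂ in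
  elt (u₁ * u₂ + vv * (- (a * c)) + vw * (- (a * d)) + ww * (- (b * d)))
      (u₁ * v₂ + u₂ * v₁ + vv * b + ww * d)
      (u₁ * w₂ + u₂ * w₁ + vv * (- a) + ww * (- c))

-- tr(1) = 3, tr(α) = b, tr(β) = -c
trO : BCF → Elt → ℤ
trO (bcf a b c d) (elt u v w) = + 3 * u + b * v - c * w

-- Cubes (A,B) of 2×2 integer matrices and Q₁ = -det(Ax + By)

record Mat2 : Set where
  constructor mat
  field m₁₁ m₁₂ m₂₁ m₂₂ : ℤ

record Cube : Set where
  constructor cube
  field CA CB : Mat2

Q₁ : Cube → BQF
Q₁ (cube (mat a₁₁ a₁₂ a₂₁ a₂₂) (mat b₁₁ b₁₂ b₂₁ b₂₂)) =
  negQ ((lin a₁₁ b₁₁ ⊗ lin a₂₂ b₂₂) ⊖ (lin a₁₂ b₁₂ ⊗ lin a₂₁ b₂₁))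

cubeK : BCF → Cube
cubeK (bcf a b c d) = cube (mat (+ 3 * a) b b c) (mat b c c (+ 3 * d))

-- 𝒞_{d_K}, d_K ≡ 1 (mod 4): m = (d_K+3)/4 given by 4m = d_K + 3
cubeC1 : ℤ → Cube
cubeC1 m = cube (mat (+ 0) (+ 3) (+ 1) (+ 0)) (mat m (+ 3) (+ 0) (- + 1))

-- 𝒞_{d_K}, d_K ≡ 0 (mod 4): m = d_K/4 (entry 3 corrected to 0)
cubeC0 : ℤ → Cube
cubeC0 m = cube (mat (+ 0) (+ 3) (+ 1) (+ 0)) (mat m (+ 0) (+ 0) (- + 1))

-- ½ q_K on O_K^0 in a basis {e₁, e₂}, given by E₁ = 3e₁, E₂ = 3e₂ ∈ O_K:
-- h = (½tr(e₁²), tr(e₁e₂), ½tr(e₂²)), i.e. 18 A = tr(E₁²), 9 B = tr(E₁E₂), 18 C = tr(E₂²).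
HalfTraceForm : BCF → Elt → Elt → BQF → Set
HalfTraceForm F E₁ E₂ (bqf A B C) =
  + 18 * A ≡ trO F (mulO F E₁ E₁) × + 9 * B ≡ trO F (mulO F E₁ E₂)
  × + 18 * C ≡ trO F (mulO F E₂ E₂)

-- 3α₀ = -b + 3α,  3β₀ = c + 3β
3α₀ : BCF → Elt
3α₀ (bcf a b c d) = elt (- b) (+ 3) (+ 0)

3β₀ : BCF → Elt
3β₀ (bcf a b c d) = elt c (+ 0) (+ 3)

3×_ : Elt → Elt
3× elt u v w = elt (+ 3 * u) (+ 3 * v) (+ 3 * w)

_+E_ : Elt → Elt → Elt
elt u v w +E elt u' v' w' = elt (u + u') (v + v') (w + w')

_-E_ : Elt → Elt → Elt
elt u v w -E elt u' v' w' = elt (u - u') (v - v') (w - w')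

Conclusion : BCF → Cube → Elt → Elt → Set
Conclusion F 𝒞 E₁ E₂ =
  ∃[ h ] (HalfTraceForm F E₁ E₂ h
          × (Composes (Q₁ (cubeK F)) (Q₁ 𝒞) h ⊎ Composes (Q₁ (cubeK F)) (Q₁ 𝒞) (invQ h)))

Cases : BCF → Cube → Set
Cases F 𝒞 =
  (ModEq (+ 3) (BCF.b F) (+ 0) → Conclusion F 𝒞 (3α₀ F) (3× 3β₀ F))
  × (ModEq (+ 3) (BCF.c F) (+ 0) → Conclusion F 𝒞 (3× 3α₀ F) (3β₀ F))
  × (ModEq (+ 3) (BCF.b F) (- BCF.c F) → Conclusion F 𝒞 (3α₀ F -E 3β₀ F) (3× 3β₀ F))
  × (ModEq (+ 3) (BCF.b F) (BCF.c F) → Conclusion F 𝒞 (3α₀ F +E 3β₀ F) (3× 3β₀ F))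

{-# OPTIONS --safe #-}
-- Write elements of O_K^0 as vα₀ + wβ₀. A direct computation gives ½ tr(x²) = H(v, w) / 3, where
-- H = (b² − 3ac, bc − 9ad, c² − 3bd) = Q₁(𝒦_F) is the Hessian of F. Each basis of the theorem spans an
-- index-3 sublattice of ℤα₀ ⊕ ℤβ₀ on which H is divisible by 3: the lattice w ≡ εv (mod 3) when
-- b ≡ εc (mod 3), and the lattice v ≡ 0 (mod 3) when c ≡ 0 (mod 3). A change of variables in SL₂(ℤ)
-- turns H into (a, 3k, 3C) and ½q_K into (3a, 3k, C), where a is a square plus a multiple of 3, so
-- 3 ∤ d_K forces a ≡ 1 (mod 3). Q₁(𝒞_{d_K}) is (3, 3, m) or (3, 0, m), of the same discriminant
-- −3d_K as H, and united with (a, 3k, 3C) since 3 ∤ a; their Dirichlet composite is (3a, 3k, C).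

module Submission where

open import Defs
open import Data.Nat using (suc; s≤s)
import Data.Nat.Divisibility as ℕ
import Data.Nat.GCD as ℕ
open import Data.Integer using (ℤ; +_; _+_; _-_; _*_; -_; ∣_∣)
open import Data.Integer.DivMod using (_%_; _/_; a≡a%n+[a/n]*n; n%d<d)
open import Data.Integer.Divisibility using (_∣_)
import Data.Integer.Divisibility.Signed as Signed
open import Data.Integer.GCD using (gcd; gcd[i,j]∣i; gcd[i,j]∣j)
open import Data.Integer.Properties using (+-identityˡ; +-identityʳ; *-identityˡ; *-comm; -1*i≡-i; neg-involutive)
open import Data.Integer.Tactic.RingSolver using (solve)
open import Data.List using (_∷_; [])
open import Data.Product using (∃-syntax; _×_; _,_)
open import Data.Sum using (_⊎_; inj₁; inj₂)
open import Data.Empty using (⊥-elim)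
open import Relation.Nullary using (¬_)
open import Function using (_∋_)
open import Relation.Binary.PropositionalEquality
  using (_≡_; refl; sym; trans; cong; subst; subst₂; module ≡-Reasoning)

open ≡-Reasoning

-- Congruences

2+n∤1 : ∀ n → ¬ (suc (suc n) ℕ.∣ 1)
2+n∤1 n 2+n∣1 with ℕ.∣1⇒≡1 2+n∣1
... | ()

modEq⇒≡ : ∀ {m x y} → ModEq m x y → ∃[ s ] x ≡ s * m + y
modEq⇒≡ {m} {x} {y} m∣x-y with Signed.∣ᵤ⇒∣ {m} {x - y} m∣x-y
... | Signed.divides s x-y≡sm = s , (begin
  x            ≡⟨ solve (x ∷ y ∷ []) ⟩
  (x - y) + y  ≡⟨ cong (_+ y) x-y≡sm ⟩
  s * m + y    ∎)

≡⇒modEq : ∀ {m x y} s → x ≡ s * m + y → ModEq m x y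
≡⇒modEq {m} {x} {y} s x≡sm+y = Signed.∣⇒∣ᵤ {m} {x - y} (Signed.divides s (begin
  x - y          ≡⟨ cong (_- y) x≡sm+y ⟩
  s * m + y - y  ≡⟨ solve (s ∷ m ∷ y ∷ []) ⟩
  s * m          ∎))

modEq-refl : ∀ m x → ModEq m x x
modEq-refl m x = ≡⇒modEq {m} {x} {x} (+ 0) (sym (+-identityˡ x))

residue-mod-two : ∀ x → ∃[ q ] (x ≡ q * + 2 ⊎ x ≡ + 1 + q * + 2)
residue-mod-two x with x % + 2 | n%d<d x (+ 2) | a≡a%n+[a/n]*n x (+ 2)
... | 0 | _ | x≡ = x / + 2 , inj₁ (trans x≡ (+-identityˡ _))
... | 1 | _ | x≡ = x / + 2 , inj₂ x≡
... | suc (suc _) | s≤s (s≤s ()) | _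

nonzero-residue-mod-three : ∀ x → ¬ (+ 3 ∣ x) → ∃[ q ] (x ≡ + 1 + q * + 3 ⊎ x ≡ + 2 + q * + 3)
nonzero-residue-mod-three x 3∤x with x % + 3 | n%d<d x (+ 3) | a≡a%n+[a/n]*n x (+ 3)
... | 0 | _ | x≡ =
  ⊥-elim (3∤x (Signed.∣⇒∣ᵤ {+ 3} {x} (Signed.divides (x / + 3) (trans x≡ (+-identityˡ _)))))
... | 1 | _ | x≡ = x / + 3 , inj₁ x≡
... | 2 | _ | x≡ = x / + 3 , inj₂ x≡
... | suc (suc (suc _)) | s≤s (s≤s (s≤s ())) | _

odd*odd≢even : ∀ q y z → ¬ ((+ 1 + q * + 2) * ((+ 1 + q * + 2) + + 2 * y) ≡ z * + 2)
odd*odd≢even q y z eq =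
  let w = + 2 * q + + 2 * q * q + y + + 2 * q * y in
  2+n∤1 0 (Signed.∣⇒∣ᵤ {+ 2} (Signed.divides (z - w) (begin
    + 1                                                       ≡⟨ solve (q ∷ y ∷ []) ⟩
    (+ 1 + q * + 2) * ((+ 1 + q * + 2) + + 2 * y) - w * + 2  ≡⟨ cong (_- w * + 2) eq ⟩
    z * + 2 - w * + 2                                         ≡⟨ solve (z ∷ q ∷ y ∷ []) ⟩
    (z - w) * + 2                                             ∎)))

square-difference-even⇒difference-even : ∀ x y z → x * x - y * y ≡ z * + 2 → ∃[ t ] x - y ≡ t * + 2
square-difference-even⇒difference-even x y z eq with residue-mod-two (x - y)
... | t , inj₁ x-y≡ = t , x-y≡
... | q , inj₂ x-y≡ = ⊥-elim (odd*odd≢even q y z (begin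
  (+ 1 + q * + 2) * ((+ 1 + q * + 2) + + 2 * y)  ≡⟨ cong (λ d → d * (d + + 2 * y)) (sym x-y≡) ⟩
  (x - y) * ((x - y) + + 2 * y)                  ≡⟨ solve (x ∷ y ∷ []) ⟩
  x * x - y * y                                  ≡⟨ eq ⟩
  z * + 2                                        ∎))

square-mod-three : ∀ e x → ¬ (+ 3 ∣ e) → ModEq (+ 3) (e * e - + 3 * x) (+ 1)
square-mod-three e x 3∤e with nonzero-residue-mod-three e 3∤e
... | q , inj₁ e≡ = ≡⇒modEq {+ 3} {e * e - + 3 * x} {+ 1} (+ 3 * q * q + + 2 * q - x) (begin
  e * e - + 3 * x                                  ≡⟨ cong (λ e → e * e - + 3 * x) e≡ ⟩
  (+ 1 + q * + 3) * (+ 1 + q * + 3) - + 3 * x      ≡⟨ solve (q ∷ x ∷ []) ⟩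
  (+ 3 * q * q + + 2 * q - x) * + 3 + + 1          ∎)
... | q , inj₂ e≡ = ≡⇒modEq {+ 3} {e * e - + 3 * x} {+ 1} (+ 3 * q * q + + 4 * q + + 1 - x) (begin
  e * e - + 3 * x                                  ≡⟨ cong (λ e → e * e - + 3 * x) e≡ ⟩
  (+ 2 + q * + 3) * (+ 2 + q * + 3) - + 3 * x      ≡⟨ solve (q ∷ x ∷ []) ⟩
  (+ 3 * q * q + + 4 * q + + 1 - x) * + 3 + + 1    ∎)

-- Binary quadratic forms

cong-bqf : ∀ {A B C A′ B′ C′} → A ≡ A′ → B ≡ B′ → C ≡ C′ → bqf A B C ≡ bqf A′ B′ C′
cong-bqf refl refl refl = refl

substQ-identity : ∀ A B C → substQ (bqf A B C) (lin (+ 1) (+ 0)) (lin (+ 0) (+ 1)) ≡ bqf A B C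
substQ-identity A B C = cong-bqf
  (A * (+ 1 * + 1) + (B * (+ 1 * + 0) + C * (+ 0 * + 0)) ≡ A ∋ solve (A ∷ B ∷ C ∷ []))
  (A * (+ 1 * + 0 + + 0 * + 1) + (B * (+ 1 * + 1 + + 0 * + 0) + C * (+ 0 * + 1 + + 1 * + 0)) ≡ B
    ∋ solve (A ∷ B ∷ C ∷ []))
  (A * (+ 0 * + 0) + (B * (+ 0 * + 1) + C * (+ 1 * + 1)) ≡ C ∋ solve (A ∷ B ∷ C ∷ []))

∼-refl : ∀ {f} → f ∼ f
∼-refl {bqf A B C} = + 1 , + 0 , + 0 , + 1 , refl , sym (substQ-identity A B C)

disc-substQ : ∀ A B C p q r s →
  disc (substQ (bqf A B C) (lin p q) (lin r s)) ≡ (p * s - q * r) * (p * s - q * r) * disc (bqf A B C)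
disc-substQ A B C p q r s =
  (let A′ = A * (p * p) + (B * (p * r) + C * (r * r))
       B′ = A * (p * q + q * p) + (B * (p * s + q * r) + C * (r * s + s * r))
       C′ = A * (q * q) + (B * (q * s) + C * (s * s))
   in B′ * B′ - + 4 * A′ * C′ ≡ (p * s - q * r) * (p * s - q * r) * (B * B - + 4 * A * C))
  ∋ solve (A ∷ B ∷ C ∷ p ∷ q ∷ r ∷ s ∷ [])

disc-∼ : ∀ {f g} → f ∼ g → disc g ≡ disc f
disc-∼ {bqf A B C} (p , q , r , s , det≡1 , refl) = begin
  disc (substQ (bqf A B C) (lin p q) (lin r s))         ≡⟨ disc-substQ A B C p q r s ⟩
  (p * s - q * r) * (p * s - q * r) * disc (bqf A B C)  ≡⟨ cong (λ δ → δ * δ * disc (bqf A B C)) det≡1 ⟩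
  + 1 * + 1 * disc (bqf A B C)                          ≡⟨ *-identityˡ _ ⟩
  disc (bqf A B C)                                      ∎

substQ-rotate : ∀ A B C → substQ (bqf A B C) (lin (+ 0) (+ 1)) (lin (- + 1) (+ 0)) ≡ bqf C (- B) A
substQ-rotate A B C = cong-bqf
  (A * (+ 0 * + 0) + (B * (+ 0 * - + 1) + C * (- + 1 * - + 1)) ≡ C ∋ solve (A ∷ B ∷ C ∷ []))
  (A * (+ 0 * + 1 + + 1 * + 0) + (B * (+ 0 * + 0 + + 1 * - + 1) + C * (- + 1 * + 0 + + 0 * - + 1)) ≡ - B
    ∋ solve (A ∷ B ∷ C ∷ []))
  (A * (+ 1 * + 1) + (B * (+ 1 * + 0) + C * (+ 0 * + 0)) ≡ A ∋ solve (A ∷ B ∷ C ∷ []))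

substQ-rotate-shear : ∀ A B C t →
  substQ (bqf A B C) (lin (+ 0) (+ 1)) (lin (- + 1) t) ≡ bqf C (- B - + 2 * C * t) (A + B * t + C * t * t)
substQ-rotate-shear A B C t = cong-bqf
  (A * (+ 0 * + 0) + (B * (+ 0 * - + 1) + C * (- + 1 * - + 1)) ≡ C ∋ solve (A ∷ B ∷ C ∷ []))
  (A * (+ 0 * + 1 + + 1 * + 0) + (B * (+ 0 * t + + 1 * - + 1) + C * (- + 1 * t + t * - + 1)) ≡ - B - + 2 * C * t
    ∋ solve (A ∷ B ∷ C ∷ t ∷ []))
  (A * (+ 1 * + 1) + (B * (+ 1 * t) + C * (t * t)) ≡ A + B * t + C * t * t ∋ solve (A ∷ B ∷ C ∷ t ∷ []))

gcd[gcd[a,3],n]≡1 : ∀ a n → ModEq (+ 3) a (+ 1) → gcd (gcd a (+ 3)) n ≡ + 1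
gcd[gcd[a,3],n]≡1 a n a≡1 with modEq⇒≡ {+ 3} {a} {+ 1} a≡1
... | q , a≡3q+1 = begin
  gcd (gcd a (+ 3)) n  ≡⟨ cong (λ g → gcd (+ g) n) gcd[a,3]≡1 ⟩
  gcd (+ 1) n          ≡⟨ cong +_ (ℕ.gcd-zeroˡ ∣ n ∣) ⟩
  + 1                  ∎
  where
  a-3q≡1 : a - q * + 3 ≡ + 1
  a-3q≡1 = begin
    a - q * + 3              ≡⟨ cong (_- q * + 3) a≡3q+1 ⟩
    q * + 3 + + 1 - q * + 3  ≡⟨ solve (q ∷ []) ⟩
    + 1                      ∎
  g∣1 : gcd a (+ 3) Signed.∣ + 1
  g∣1 = subst (gcd a (+ 3) Signed.∣_) a-3q≡1
    (Signed.∣m∣n⇒∣m-n (Signed.∣ᵤ⇒∣ {gcd a (+ 3)} {a} (gcd[i,j]∣i a (+ 3)))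
      (Signed.∣n⇒∣m*n q (Signed.∣ᵤ⇒∣ {gcd a (+ 3)} {+ 3} (gcd[i,j]∣j a (+ 3)))))
  gcd[a,3]≡1 : ℕ.gcd ∣ a ∣ 3 ≡ 1
  gcd[a,3]≡1 = ℕ.∣1⇒≡1 (Signed.∣⇒∣ᵤ {gcd a (+ 3)} {+ 1} g∣1)

half-sum : ∀ x y t → x - y ≡ t * + 2 → x + y ≡ + 2 * (t + y)
half-sum x y t x-y≡2t = begin
  x + y              ≡⟨ solve (x ∷ y ∷ []) ⟩
  (x - y) + + 2 * y  ≡⟨ cong (_+ + 2 * y) x-y≡2t ⟩
  t * + 2 + + 2 * y  ≡⟨ solve (t ∷ y ∷ []) ⟩
  + 2 * (t + y)      ∎

congruent-mod-six : ∀ k k₂ t → + 3 * k - + 3 * k₂ ≡ t * + 2 → ModEq (+ 6) (+ 3 * k) (+ 3 * k₂)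
congruent-mod-six k k₂ t 3k-3k₂≡2t = ≡⇒modEq {+ 6} {+ 3 * k} {+ 3 * k₂} (t - (k - k₂)) (begin
  + 3 * k                                                  ≡⟨ solve (k ∷ k₂ ∷ []) ⟩
  + 3 * (+ 3 * k - + 3 * k₂) - + 6 * (k - k₂) + + 3 * k₂
    ≡⟨ cong (λ u → + 3 * u - + 6 * (k - k₂) + + 3 * k₂) 3k-3k₂≡2t ⟩
  + 3 * (t * + 2) - + 6 * (k - k₂) + + 3 * k₂             ≡⟨ solve (k ∷ k₂ ∷ t ∷ []) ⟩
  (t - (k - k₂)) * + 6 + + 3 * k₂                         ∎)

-- Equal discriminants give (3k)² ≡ (3k₂)² (mod 12), hence 3k ≡ 3k₂ (mod 6).
composes-with-three : ∀ {f g h a₁ k C k₂ c₂} →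
  f ∼ bqf a₁ (+ 3 * k) (+ 3 * C) → g ∼ bqf (+ 3) (+ 3 * k₂) c₂ → h ∼ bqf (a₁ * + 3) (+ 3 * k) C →
  ModEq (+ 3) a₁ (+ 1) → disc f ≡ disc g → Composes f g h
composes-with-three {f} {g} {h} {a₁} {k} {C} {k₂} {c₂} f∼ g∼ h∼ a₁≡1 disc-f≡disc-g =
  assemble (square-difference-even⇒difference-even (+ 3 * k) (+ 3 * k₂) (+ 6 * (a₁ * C - c₂)) squares)
  where
  discs : (+ 3 * k) * (+ 3 * k) - + 4 * a₁ * (+ 3 * C) ≡ (+ 3 * k₂) * (+ 3 * k₂) - + 4 * + 3 * c₂
  discs = trans (disc-∼ {f} {bqf a₁ (+ 3 * k) (+ 3 * C)} f∼)
    (trans disc-f≡disc-g (sym (disc-∼ {g} {bqf (+ 3) (+ 3 * k₂) c₂} g∼)))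
  squares : (+ 3 * k) * (+ 3 * k) - (+ 3 * k₂) * (+ 3 * k₂) ≡ + 6 * (a₁ * C - c₂) * + 2
  squares = begin
    (+ 3 * k) * (+ 3 * k) - (+ 3 * k₂) * (+ 3 * k₂)
      ≡⟨ solve (k ∷ k₂ ∷ a₁ ∷ C ∷ c₂ ∷ []) ⟩
    ((+ 3 * k) * (+ 3 * k) - + 4 * a₁ * (+ 3 * C)) - ((+ 3 * k₂) * (+ 3 * k₂) - + 4 * + 3 * c₂)
      + + 6 * (a₁ * C - c₂) * + 2
      ≡⟨ cong (λ u → u - ((+ 3 * k₂) * (+ 3 * k₂) - + 4 * + 3 * c₂) + + 6 * (a₁ * C - c₂) * + 2) discs ⟩
    ((+ 3 * k₂) * (+ 3 * k₂) - + 4 * + 3 * c₂) - ((+ 3 * k₂) * (+ 3 * k₂) - + 4 * + 3 * c₂)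
      + + 6 * (a₁ * C - c₂) * + 2
      ≡⟨ solve (k₂ ∷ a₁ ∷ C ∷ c₂ ∷ []) ⟩
    + 6 * (a₁ * C - c₂) * + 2 ∎
  a₁≢0 : ¬ a₁ ≡ + 0
  a₁≢0 a₁≡0 = 2+n∤1 1 (subst (λ a → ModEq (+ 3) a (+ 1)) a₁≡0 a₁≡1)
  disc-h : + 3 * k * (+ 3 * k) - + 4 * (a₁ * + 3) * C ≡ disc f
  disc-h = trans ((+ 3 * k * (+ 3 * k) - + 4 * (a₁ * + 3) * C ≡ (+ 3 * k) * (+ 3 * k) - + 4 * a₁ * (+ 3 * C))
    ∋ solve (k ∷ a₁ ∷ C ∷ [])) (disc-∼ {f} {bqf a₁ (+ 3 * k) (+ 3 * C)} f∼)
  assemble : ∃[ t ] + 3 * k - + 3 * k₂ ≡ t * + 2 → Composes f g h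
  assemble (t , 3k-3k₂≡2t) =
    a₁ , + 3 * k , + 3 * C , + 3 , + 3 * k₂ , c₂ , t + + 3 * k₂ , + 3 * k , C ,
    f∼ , g∼ , a₁≢0 , (λ ()) , half-sum (+ 3 * k) (+ 3 * k₂) t 3k-3k₂≡2t ,
    gcd[gcd[a,3],n]≡1 a₁ (t + + 3 * k₂) a₁≡1 ,
    modEq-refl (+ 2 * a₁) (+ 3 * k) , congruent-mod-six k k₂ t 3k-3k₂≡2t , disc-h , h∼

record IndexThree (H : BQF) (L₁ L₂ : LinForm) : Set where
  field
    lead mid last : ℤ
    form : BQF
    reduces : H ∼ bqf lead (+ 3 * mid) (+ 3 * last)
    form-reduces : form ∼ bqf (lead * + 3) (+ 3 * mid) last
    restricts : (+ 3) · form ≡ substQ H L₁ L₂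

index-three-shear : ∀ A B C ε → + 3 Signed.∣ - B - + 2 * C * ε → + 3 Signed.∣ A + B * ε + C * ε * ε →
  IndexThree (bqf A B C) (lin (+ 1) (+ 0)) (lin ε (+ 3))
index-three-shear A B C ε (Signed.divides k middle≡3k) (Signed.divides C′ value≡3C′) = record
  { lead = C ; mid = k ; last = C′
  ; form = bqf C′ (- (+ 3 * k)) (C * + 3)
  ; reduces = + 0 , + 1 , - + 1 , ε , refl ,
      sym (trans (substQ-rotate-shear A B C ε)
        (cong-bqf refl (trans middle≡3k (*-comm k (+ 3))) (trans value≡3C′ (*-comm C′ (+ 3)))))
  ; form-reduces = + 0 , + 1 , - + 1 , + 0 , refl ,
      sym (trans (substQ-rotate C′ (- (+ 3 * k)) (C * + 3)) (cong-bqf refl (neg-involutive _) refl))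
  ; restricts = cong-bqf restricts-A restricts-B restricts-C
  }
  where
  restricts-A : + 3 * C′ ≡ A * (+ 1 * + 1) + (B * (+ 1 * ε) + C * (ε * ε))
  restricts-A = begin
    + 3 * C′                                         ≡⟨ *-comm (+ 3) C′ ⟩
    C′ * + 3                                         ≡⟨ sym value≡3C′ ⟩
    A + B * ε + C * ε * ε                            ≡⟨ solve (A ∷ B ∷ C ∷ ε ∷ []) ⟩
    A * (+ 1 * + 1) + (B * (+ 1 * ε) + C * (ε * ε))  ∎
  restricts-B : + 3 * - (+ 3 * k) ≡ A * (+ 1 * + 0 + + 0 * + 1) + (B * (+ 1 * + 3 + + 0 * ε) + C * (ε * + 3 + + 3 * ε))
  restricts-B = begin
    + 3 * - (+ 3 * k)                ≡⟨ cong (λ u → + 3 * - u) (*-comm (+ 3) k) ⟩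
    + 3 * - (k * + 3)                ≡⟨ cong (λ u → + 3 * - u) (sym middle≡3k) ⟩
    + 3 * - (- B - + 2 * C * ε)      ≡⟨ solve (A ∷ B ∷ C ∷ ε ∷ []) ⟩
    A * (+ 1 * + 0 + + 0 * + 1) + (B * (+ 1 * + 3 + + 0 * ε) + C * (ε * + 3 + + 3 * ε)) ∎
  restricts-C : + 3 * (C * + 3) ≡ A * (+ 0 * + 0) + (B * (+ 0 * + 3) + C * (+ 3 * + 3))
  restricts-C = solve (A ∷ B ∷ C ∷ [])

index-three-diagonal : ∀ A B C → + 3 Signed.∣ B → + 3 Signed.∣ C →
  IndexThree (bqf A B C) (lin (+ 3) (+ 0)) (lin (+ 0) (+ 1))
index-three-diagonal A B C (Signed.divides k B≡3k) (Signed.divides C′ C≡3C′) = record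
  { lead = A ; mid = k ; last = C′
  ; form = bqf (A * + 3) (+ 3 * k) C′
  ; reduces = subst (_∼ bqf A (+ 3 * k) (+ 3 * C′)) (sym H≡) (∼-refl {bqf A (+ 3 * k) (+ 3 * C′)})
  ; form-reduces = ∼-refl {bqf (A * + 3) (+ 3 * k) C′}
  ; restricts = subst (λ H → (+ 3) · bqf (A * + 3) (+ 3 * k) C′ ≡ substQ H (lin (+ 3) (+ 0)) (lin (+ 0) (+ 1)))
      (sym H≡) restricts
  }
  where
  H≡ : bqf A B C ≡ bqf A (+ 3 * k) (+ 3 * C′)
  H≡ = cong-bqf refl (trans B≡3k (*-comm k (+ 3))) (trans C≡3C′ (*-comm C′ (+ 3)))
  restricts :
    (+ 3) · bqf (A * + 3) (+ 3 * k) C′ ≡ substQ (bqf A (+ 3 * k) (+ 3 * C′)) (lin (+ 3) (+ 0)) (lin (+ 0) (+ 1))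
  restricts = cong-bqf
    (+ 3 * (A * + 3) ≡ A * (+ 3 * + 3) + (+ 3 * k * (+ 3 * + 0) + + 3 * C′ * (+ 0 * + 0))
      ∋ solve (A ∷ k ∷ C′ ∷ []))
    (+ 3 * (+ 3 * k)
       ≡ A * (+ 3 * + 0 + + 0 * + 3) + (+ 3 * k * (+ 3 * + 1 + + 0 * + 0) + + 3 * C′ * (+ 0 * + 1 + + 1 * + 0))
      ∋ solve (A ∷ k ∷ C′ ∷ []))
    (+ 3 * C′ ≡ A * (+ 0 * + 0) + (+ 3 * k * (+ 0 * + 1) + + 3 * C′ * (+ 1 * + 1))
      ∋ solve (A ∷ k ∷ C′ ∷ []))

polar : BQF → ℤ → ℤ → ℤ → ℤ → ℤ
polar (bqf A B C) v₁ w₁ v₂ w₂ = + 2 * A * v₁ * v₂ + B * (v₁ * w₂ + w₁ * v₂) + + 2 * C * w₁ * w₂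

restriction-polar : ∀ H v₁ w₁ v₂ w₂ h → (+ 3) · h ≡ substQ H (lin v₁ v₂) (lin w₁ w₂) →
  (+ 18 * BQF.A h ≡ + 3 * polar H v₁ w₁ v₁ w₁)
  × (+ 9 * BQF.B h ≡ + 3 * polar H v₁ w₁ v₂ w₂)
  × (+ 18 * BQF.C h ≡ + 3 * polar H v₂ w₂ v₂ w₂)
restriction-polar (bqf A B C) v₁ w₁ v₂ w₂ (bqf hA hB hC) eq =
  diagonal v₁ w₁ hA (cong BQF.A eq) , off-diagonal (cong BQF.B eq) , diagonal v₂ w₂ hC (cong BQF.C eq)
  where
  diagonal : ∀ v w X → + 3 * X ≡ A * (v * v) + (B * (v * w) + C * (w * w)) →
    + 18 * X ≡ + 3 * polar (bqf A B C) v w v w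
  diagonal v w X 3X≡ = begin
    + 18 * X                                               ≡⟨ solve (X ∷ []) ⟩
    + 6 * (+ 3 * X)                                        ≡⟨ cong (+ 6 *_) 3X≡ ⟩
    + 6 * (A * (v * v) + (B * (v * w) + C * (w * w)))      ≡⟨ solve (A ∷ B ∷ C ∷ v ∷ w ∷ []) ⟩
    + 3 * (+ 2 * A * v * v + B * (v * w + w * v) + + 2 * C * w * w) ∎
  off-diagonal :
    + 3 * hB ≡ A * (v₁ * v₂ + v₂ * v₁) + (B * (v₁ * w₂ + v₂ * w₁) + C * (w₁ * w₂ + w₂ * w₁)) →
    + 9 * hB ≡ + 3 * polar (bqf A B C) v₁ w₁ v₂ w₂
  off-diagonal 3hB≡ = begin
    + 9 * hB                                                                       ≡⟨ solve (hB ∷ []) ⟩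
    + 3 * (+ 3 * hB)                                                               ≡⟨ cong (+ 3 *_) 3hB≡ ⟩
    + 3 * (A * (v₁ * v₂ + v₂ * v₁) + (B * (v₁ * w₂ + v₂ * w₁) + C * (w₁ * w₂ + w₂ * w₁)))
      ≡⟨ solve (A ∷ B ∷ C ∷ v₁ ∷ w₁ ∷ v₂ ∷ w₂ ∷ []) ⟩
    + 3 * (+ 2 * A * v₁ * v₂ + B * (v₁ * w₂ + w₁ * v₂) + + 2 * C * w₁ * w₂) ∎

-- The trace form of the cubic ring

hessian : BCF → BQF
hessian (bcf a b c d) = bqf (b * b - + 3 * (a * c)) (b * c - + 9 * (a * d)) (c * c - + 3 * (b * d))

-- traceless F v w = 3(vα₀ + wβ₀), as 3α₀ = 3α − b and 3β₀ = 3β + c.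
traceless : BCF → ℤ → ℤ → Elt
traceless (bcf a b c d) v w = elt (c * w - b * v) (+ 3 * v) (+ 3 * w)

Q₁-cubeK : ∀ F → Q₁ (cubeK F) ≡ hessian F
Q₁-cubeK (bcf a b c d) = cong-bqf
  (- (+ 3 * a * c - b * b) ≡ b * b - + 3 * (a * c) ∋ solve (a ∷ b ∷ c ∷ []))
  (- (+ 3 * a * (+ 3 * d) + b * c - (b * c + c * b)) ≡ b * c - + 9 * (a * d) ∋ solve (a ∷ b ∷ c ∷ d ∷ []))
  (- (b * (+ 3 * d) - c * c) ≡ c * c - + 3 * (b * d) ∋ solve (b ∷ c ∷ d ∷ []))

disc-hessian : ∀ F → disc (hessian F) ≡ - (+ 3 * discC F)
disc-hessian (bcf a b c d) =
  (b * c - + 9 * (a * d)) * (b * c - + 9 * (a * d)) - + 4 * (b * b - + 3 * (a * c)) * (c * c - + 3 * (b * d))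
    ≡ - (+ 3 * (b * b * c * c - + 4 * a * c * c * c - + 4 * b * b * b * d
                - + 27 * a * a * d * d + + 18 * a * b * c * d))
  ∋ solve (a ∷ b ∷ c ∷ d ∷ [])

trace-traceless : ∀ F v₁ w₁ v₂ w₂ →
  trO F (mulO F (traceless F v₁ w₁) (traceless F v₂ w₂)) ≡ + 3 * polar (hessian F) v₁ w₁ v₂ w₂
trace-traceless (bcf a b c d) v₁ w₁ v₂ w₂ =
  (let U₁ = c * w₁ - b * v₁ ; V₁ = + 3 * v₁ ; W₁ = + 3 * w₁
       U₂ = c * w₂ - b * v₂ ; V₂ = + 3 * v₂ ; W₂ = + 3 * w₂
   in + 3 * (U₁ * U₂ + V₁ * V₂ * - (a * c) + (V₁ * W₂ + W₁ * V₂) * - (a * d) + W₁ * W₂ * - (b * d))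
      + b * (U₁ * V₂ + U₂ * V₁ + V₁ * V₂ * b + W₁ * W₂ * d)
      - c * (U₁ * W₂ + U₂ * W₁ + V₁ * V₂ * - a + W₁ * W₂ * - c)
      ≡ + 3 * (+ 2 * (b * b - + 3 * (a * c)) * v₁ * v₂ + (b * c - + 9 * (a * d)) * (v₁ * w₂ + w₁ * v₂)
               + + 2 * (c * c - + 3 * (b * d)) * w₁ * w₂))
  ∋ solve (a ∷ b ∷ c ∷ d ∷ v₁ ∷ w₁ ∷ v₂ ∷ w₂ ∷ [])

halfTraceForm-of-restriction : ∀ F {v₁ w₁ v₂ w₂} h →
  (+ 3) · h ≡ substQ (hessian F) (lin v₁ v₂) (lin w₁ w₂) →
  HalfTraceForm F (traceless F v₁ w₁) (traceless F v₂ w₂) h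
halfTraceForm-of-restriction F {v₁} {w₁} {v₂} {w₂} h eq =
  let 18A≡ , 9B≡ , 18C≡ = restriction-polar (hessian F) v₁ w₁ v₂ w₂ h eq in
  trans 18A≡ (sym (trace-traceless F v₁ w₁ v₁ w₁)) ,
  trans 9B≡ (sym (trace-traceless F v₁ w₁ v₂ w₂)) ,
  trans 18C≡ (sym (trace-traceless F v₂ w₂ v₂ w₂))

three∣discC : ∀ {a b c d} → + 3 Signed.∣ b → + 3 Signed.∣ c → + 3 ∣ discC (bcf a b c d)
three∣discC {a} {d = d} (Signed.divides β refl) (Signed.divides γ refl) =
  Signed.∣⇒∣ᵤ {+ 3} {discC (bcf a (β * + 3) (γ * + 3) d)} (Signed.divides
    (+ 27 * β * β * γ * γ - + 36 * a * γ * γ * γ - + 36 * β * β * β * d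
     - + 9 * a * a * d * d + + 54 * a * β * γ * d)
    ((let b = β * + 3 ; c = γ * + 3
      in b * b * c * c - + 4 * a * c * c * c - + 4 * b * b * b * d - + 27 * a * a * d * d + + 18 * a * b * c * d
         ≡ (+ 27 * β * β * γ * γ - + 36 * a * γ * γ * γ - + 36 * β * β * β * d
            - + 9 * a * a * d * d + + 54 * a * β * γ * d) * + 3)
     ∋ solve (a ∷ β ∷ γ ∷ d ∷ [])))

-- The composition

record CompanionCube (F : BCF) (𝒞 : Cube) : Set where
  field
    k₂ c₂ : ℤ
    Q₁≡ : Q₁ 𝒞 ≡ bqf (+ 3) (+ 3 * k₂) c₂
    disc≡ : disc (Q₁ 𝒞) ≡ - (+ 3 * discC F)

index-three⇒conclusion : ∀ {F 𝒞 v₁ w₁ v₂ w₂} → CompanionCube F 𝒞 →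
  (N : IndexThree (hessian F) (lin v₁ v₂) (lin w₁ w₂)) → ModEq (+ 3) (IndexThree.lead N) (+ 1) →
  Conclusion F 𝒞 (traceless F v₁ w₁) (traceless F v₂ w₂)
index-three⇒conclusion {F} {𝒞} companion N lead≡1 =
  form , halfTraceForm-of-restriction F form restricts ,
  inj₁ (composes-with-three {Q₁ (cubeK F)} {Q₁ 𝒞} {form} {lead} {mid} {last} {k₂} {c₂}
          Q₁𝒦-reduces Q₁𝒞-reduces form-reduces lead≡1 discs)
  where
  open IndexThree N
  open CompanionCube companion
  Q₁𝒦-reduces : Q₁ (cubeK F) ∼ bqf lead (+ 3 * mid) (+ 3 * last)
  Q₁𝒦-reduces = subst (_∼ bqf lead (+ 3 * mid) (+ 3 * last)) (sym (Q₁-cubeK F)) reduces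
  Q₁𝒞-reduces : Q₁ 𝒞 ∼ bqf (+ 3) (+ 3 * k₂) c₂
  Q₁𝒞-reduces = subst (_∼ bqf (+ 3) (+ 3 * k₂) c₂) (sym Q₁≡) (∼-refl {bqf (+ 3) (+ 3 * k₂) c₂})
  discs : disc (Q₁ (cubeK F)) ≡ disc (Q₁ 𝒞)
  discs = trans (cong disc (Q₁-cubeK F)) (trans (disc-hessian F) (sym disc≡))

-- ε = 0, −1, 1 are the cases b ≡ 0, b ≡ −c, b ≡ c, with basis {α₀ + εβ₀, 3β₀}.
b≡εc⇒conclusion : ∀ {a b c d 𝒞} s ε → b ≡ s * + 3 + ε * c → ¬ (+ 3 ∣ discC (bcf a b c d)) →
  CompanionCube (bcf a b c d) 𝒞 →
  Conclusion (bcf a b c d) 𝒞 (traceless (bcf a b c d) (+ 1) ε) (traceless (bcf a b c d) (+ 0) (+ 3))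
b≡εc⇒conclusion {a} {_} {c} {d} s ε refl 3∤D companion =
  index-three⇒conclusion companion
    (index-three-shear _ _ _ ε middle value)
    (square-mod-three c ((s * + 3 + ε * c) * d) 3∤c)
  where
  middle : + 3 Signed.∣ (let b = s * + 3 + ε * c in - (b * c - + 9 * (a * d)) - + 2 * (c * c - + 3 * (b * d)) * ε)
  middle = Signed.divides (- (s * c) - ε * c * c + + 3 * (a * d) + + 2 * ε * (s * + 3 + ε * c) * d)
    (solve (a ∷ s ∷ c ∷ d ∷ ε ∷ []))
  value : + 3 Signed.∣
    (let b = s * + 3 + ε * c in b * b - + 3 * (a * c) + (b * c - + 9 * (a * d)) * ε + (c * c - + 3 * (b * d)) * ε * ε)
  value = Signed.divides
    (+ 3 * s * s + + 3 * s * ε * c + ε * ε * c * c - a * c - + 3 * ε * a * d - ε * ε * (s * + 3 + ε * c) * d)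
    (solve (a ∷ s ∷ c ∷ d ∷ ε ∷ []))
  3∤c : ¬ (+ 3 ∣ c)
  3∤c 3∣c =
    3∤D (three∣discC {a} {d = d} (Signed.∣m∣n⇒∣m+n (Signed.divides s refl) (Signed.∣n⇒∣m*n ε 3∣ₛc)) 3∣ₛc)
    where
    3∣ₛc : + 3 Signed.∣ c
    3∣ₛc = Signed.∣ᵤ⇒∣ {+ 3} {c} 3∣c

c≡0⇒conclusion : ∀ {a b c d 𝒞} γ → c ≡ γ * + 3 → ¬ (+ 3 ∣ discC (bcf a b c d)) →
  CompanionCube (bcf a b c d) 𝒞 →
  Conclusion (bcf a b c d) 𝒞 (traceless (bcf a b c d) (+ 3) (+ 0)) (traceless (bcf a b c d) (+ 0) (+ 1))
c≡0⇒conclusion {a} {b} {_} {d} γ refl 3∤D companion =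
  index-three⇒conclusion companion
    (index-three-diagonal _ _ _ middle last)
    (square-mod-three b (a * (γ * + 3)) 3∤b)
  where
  middle : + 3 Signed.∣ b * (γ * + 3) - + 9 * (a * d)
  middle = Signed.divides (b * γ - + 3 * (a * d)) (solve (a ∷ b ∷ d ∷ γ ∷ []))
  last : + 3 Signed.∣ γ * + 3 * (γ * + 3) - + 3 * (b * d)
  last = Signed.divides (+ 3 * γ * γ - b * d) (solve (b ∷ d ∷ γ ∷ []))
  3∤b : ¬ (+ 3 ∣ b)
  3∤b 3∣b = 3∤D (three∣discC {a} {d = d} (Signed.∣ᵤ⇒∣ {+ 3} {b} 3∣b) (Signed.divides γ refl))

cubeC1-is-companion : ∀ {F m} → + 4 * m ≡ discC F + + 3 → CompanionCube F (cubeC1 m)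
cubeC1-is-companion {F} {m} 4m≡D+3 = record
  { k₂ = + 1 ; c₂ = m ; Q₁≡ = Q₁≡ ; disc≡ = trans (cong disc Q₁≡) (disc≡ (discC F) 4m≡D+3) }
  where
  Q₁≡ : Q₁ (cubeC1 m) ≡ bqf (+ 3) (+ 3) m
  Q₁≡ = cong-bqf refl
    (- (+ 0 * - + 1 + m * + 0 - (+ 3 * + 0 + + 3 * + 1)) ≡ + 3 ∋ solve (m ∷ []))
    (- (m * - + 1 - + 3 * + 0) ≡ m ∋ solve (m ∷ []))
  disc≡ : ∀ D → + 4 * m ≡ D + + 3 → + 3 * + 3 - + 4 * + 3 * m ≡ - (+ 3 * D)
  disc≡ D 4m≡D+3 = begin
    + 3 * + 3 - + 4 * + 3 * m        ≡⟨ solve (m ∷ []) ⟩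
    - (+ 3 * (+ 4 * m - + 3))        ≡⟨ cong (λ x → - (+ 3 * (x - + 3))) 4m≡D+3 ⟩
    - (+ 3 * (D + + 3 - + 3))        ≡⟨ cong (λ x → - (+ 3 * x)) (solve (D ∷ [])) ⟩
    - (+ 3 * D)                      ∎

cubeC0-is-companion : ∀ {F m} → + 4 * m ≡ discC F → CompanionCube F (cubeC0 m)
cubeC0-is-companion {F} {m} 4m≡D = record
  { k₂ = + 0 ; c₂ = m ; Q₁≡ = Q₁≡ ; disc≡ = trans (cong disc Q₁≡) (disc≡ (discC F) 4m≡D) }
  where
  Q₁≡ : Q₁ (cubeC0 m) ≡ bqf (+ 3) (+ 0) m
  Q₁≡ = cong-bqf refl
    (- (+ 0 * - + 1 + m * + 0 - (+ 3 * + 0 + + 0 * + 1)) ≡ + 0 ∋ solve (m ∷ []))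
    (- (m * - + 1 - + 0 * + 0) ≡ m ∋ solve (m ∷ []))
  disc≡ : ∀ D → + 4 * m ≡ D → + 0 * + 0 - + 4 * + 3 * m ≡ - (+ 3 * D)
  disc≡ D 4m≡D = begin
    + 0 * + 0 - + 4 * + 3 * m  ≡⟨ solve (m ∷ []) ⟩
    - (+ 3 * (+ 4 * m))        ≡⟨ cong (λ x → - (+ 3 * x)) 4m≡D ⟩
    - (+ 3 * D)                ∎

traceless≡ : ∀ {u} F v w → BCF.c F * w - BCF.b F * v ≡ u → traceless F v w ≡ elt u (+ 3 * v) (+ 3 * w)
traceless≡ (bcf a b c d) v w refl = refl

companion⇒cases : ∀ {F 𝒞} → ¬ (+ 3 ∣ discC F) → CompanionCube F 𝒞 → Cases F 𝒞
companion⇒cases {F@(bcf a b c d)} {𝒞} 3∤D companion = b≡0 , c≡0 , b≡-c , b≡c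
  where
  traceless≡9β₀ : traceless F (+ 0) (+ 3) ≡ 3× 3β₀ F
  traceless≡9β₀ = traceless≡ F (+ 0) (+ 3) (c * + 3 - b * + 0 ≡ + 3 * c ∋ solve (b ∷ c ∷ []))
  traceless≡3α₀ : traceless F (+ 1) (+ 0) ≡ 3α₀ F
  traceless≡3α₀ = traceless≡ F (+ 1) (+ 0) (c * + 0 - b * + 1 ≡ - b ∋ solve (b ∷ c ∷ []))
  traceless≡9α₀ : traceless F (+ 3) (+ 0) ≡ 3× 3α₀ F
  traceless≡9α₀ = traceless≡ F (+ 3) (+ 0) (c * + 0 - b * + 3 ≡ + 3 * - b ∋ solve (b ∷ c ∷ []))
  traceless≡3β₀ : traceless F (+ 0) (+ 1) ≡ 3β₀ F
  traceless≡3β₀ = traceless≡ F (+ 0) (+ 1) (c * + 1 - b * + 0 ≡ c ∋ solve (b ∷ c ∷ []))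
  traceless≡3α₀-3β₀ : traceless F (+ 1) (- + 1) ≡ 3α₀ F -E 3β₀ F
  traceless≡3α₀-3β₀ = traceless≡ F (+ 1) (- + 1) (c * - + 1 - b * + 1 ≡ - b - c ∋ solve (b ∷ c ∷ []))
  traceless≡3α₀+3β₀ : traceless F (+ 1) (+ 1) ≡ 3α₀ F +E 3β₀ F
  traceless≡3α₀+3β₀ = traceless≡ F (+ 1) (+ 1) (c * + 1 - b * + 1 ≡ - b + c ∋ solve (b ∷ c ∷ []))
  b≡0 : ModEq (+ 3) b (+ 0) → Conclusion F 𝒞 (3α₀ F) (3× 3β₀ F)
  b≡0 b≡0[3] = let s , b≡ = modEq⇒≡ {+ 3} {b} {+ 0} b≡0[3] in
    subst₂ (Conclusion F 𝒞) traceless≡3α₀ traceless≡9β₀ (b≡εc⇒conclusion s (+ 0) b≡ 3∤D companion)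
  c≡0 : ModEq (+ 3) c (+ 0) → Conclusion F 𝒞 (3× 3α₀ F) (3β₀ F)
  c≡0 c≡0[3] = let γ , c≡ = modEq⇒≡ {+ 3} {c} {+ 0} c≡0[3] in
    subst₂ (Conclusion F 𝒞) traceless≡9α₀ traceless≡3β₀
      (c≡0⇒conclusion γ (trans c≡ (+-identityʳ _)) 3∤D companion)
  b≡-c : ModEq (+ 3) b (- c) → Conclusion F 𝒞 (3α₀ F -E 3β₀ F) (3× 3β₀ F)
  b≡-c b≡-c[3] = let s , b≡ = modEq⇒≡ {+ 3} {b} {(- c)} b≡-c[3] in
    subst₂ (Conclusion F 𝒞) traceless≡3α₀-3β₀ traceless≡9β₀
      (b≡εc⇒conclusion s (- + 1) (trans b≡ (cong (λ x → s * + 3 + x) (sym (-1*i≡-i c)))) 3∤D companion)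
  b≡c : ModEq (+ 3) b c → Conclusion F 𝒞 (3α₀ F +E 3β₀ F) (3× 3β₀ F)
  b≡c b≡c[3] = let s , b≡ = modEq⇒≡ {+ 3} {b} {c} b≡c[3] in
    subst₂ (Conclusion F 𝒞) traceless≡3α₀+3β₀ traceless≡9β₀
      (b≡εc⇒conclusion s (+ 1) (trans b≡ (cong (λ x → s * + 3 + x) (sym (*-identityˡ c)))) 3∤D companion)

theorem6p2 : (F : BCF) → IrreducibleC F → Fundamental (discC F) → ¬ (+ 3 ∣ discC F) →
    ((m : ℤ) → + 4 * m ≡ discC F + + 3 → Cases F (cubeC1 m))
    × ((m : ℤ) → + 4 * m ≡ discC F → Cases F (cubeC0 m))
theorem6p2 F _ _ 3∤D =
  (λ m 4m≡D+3 → companion⇒cases {F} {cubeC1 m} 3∤D (cubeC1-is-companion 4m≡D+3)) ,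
  (λ m 4m≡D → companion⇒cases {F} {cubeC0 m} 3∤D (cubeC0-is-companion 4m≡D))
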